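{- Let $\mathcal{M}=(E,\mathcal{L})$ be a simple oriented matroid with topes $\mathcal{T}$, and let $\mathcal{Q}\subseteq\mathcal{T}$ be a convex subset of topes. Then for every tope $B\in\mathcal{Q}$ there is a linear extension of the tope poset $\mathcal{T}(\mathcal{M},B)$ with respect to which all the topes in $\mathcal{Q}$ come first.
   Context: For sign vectors: $(\sigma\circ\tau)_e=\sigma_e$ if $\sigma_e\ne0$, else $\tau_e$; $S(\sigma,\tau)=\{e\mid\sigma_e=-\tau_e\ne0\}$. An oriented matroid $\mathcal{M}=(E,\mathcal{L})$ is a finite $E$ with $\mathcal{L}\subseteq\{+,-,0\}^E$ such that $\mathbf0\in\mathcal{L}$, $-\mathcal{L}=\mathcal{L}$, $\mathcal{L}$ closed under $\circ$, and for $\sigma,\tau\in\mathcal{L}$, $e\in S(\sigma,\tau)$ there is $\eta\in\mathcal{L}$ with $\eta_e=0$, $\eta_f=(\sigma\circ\tau)_f=(\tau\circ\sigma)_f$ for $f\notin S(\sigma,\tau)$. Simple: no loops and no parallel pairs. Topes $\mathcal{T}$ are the maximal covectors in the componentwise order ($0<+,0<-$). For $B\in\mathcal{T}$, the tope poset $\mathcal{T}(\mathcal{M},B)$ is $\mathcal{T}$ ordered by $R\le T$ iff $S(B,R)\subseteq S(B,T)$. For $e\in E$ and $\epsilon\in\{+,-\}$, the halfspace $\mathcal{T}^\epsilon_e=\{T\in\mathcal{T}\mid T_e=\epsilon\}$. The convex hull of $\mathcal{Q}\subseteq\mathcal{T}$ is the intersection of all halfspaces containing $\mathcal{Q}$,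 and $\mathcal{Q}$ is convex if it equals its convex hull. A linear extension of a poset is a total order refining its partial order. -}

module Defs where

open import Data.Nat using (ℕ; _≤_; _<_)
open import Data.Fin using (Fin; toℕ)
open import Data.Vec using (Vec; lookup; zipWith)
open import Data.List using (List; length)
import Data.List as L
open import Data.List.Membership.Propositional using (_∈_; _∉_)
open import Data.List.Relation.Unary.Unique.Propositional using (Unique)
open import Data.Product using (Σ; _×_; ∃; ∃-syntax)
open import Data.Sum using (_⊎_)
open import Relation.Binary.PropositionalEquality using (_≡_; _≢_)
open import Relation.Nullary using (¬_)

data Sign : Set where
  ⊕ ⊖ 𝟘 : Sign

-negS : Sign → Sign
-negS ⊕ = ⊖
-negS ⊖ = ⊕
-negS 𝟘 = 𝟘

SignVec : ℕ → Set
SignVec n = Vec Sign n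

_∘S_ : Sign → Sign → Sign
⊕ ∘S _ = ⊕
⊖ ∘S _ = ⊖
𝟘 ∘S t = t

_∘v_ : ∀ {n} → SignVec n → SignVec n → SignVec n
σ ∘v τ = zipWith _∘S_ σ τ

negV : ∀ {n} → SignVec n → SignVec n
negV σ = Data.Vec.map -negS σ

zeroV : ∀ {n} → SignVec n
zeroV = Data.Vec.replicate _ 𝟘

Sep : ∀ {n} → SignVec n → SignVec n → Fin n → Set
Sep σ τ e = (lookup σ e ≡ -negS (lookup τ e)) × (lookup σ e ≢ 𝟘)

_≤s_ : Sign → Sign → Set
s ≤s t = (s ≡ t) ⊎ (s ≡ 𝟘)

_≤v_ : ∀ {n} → SignVec n → SignVec n → Set
σ ≤v τ = ∀ e → lookup σ e ≤s lookup τ e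

record IsOrientedMatroid {n : ℕ} (𝓛 : List (SignVec n)) : Set where
  field
    zero∈   : zeroV ∈ 𝓛
    neg∈    : ∀ σ → σ ∈ 𝓛 → negV σ ∈ 𝓛
    comp∈   : ∀ σ τ → σ ∈ 𝓛 → τ ∈ 𝓛 → (σ ∘v τ) ∈ 𝓛
    elim    : ∀ σ τ e → σ ∈ 𝓛 → τ ∈ 𝓛 → Sep σ τ e →
              ∃[ η ] (η ∈ 𝓛 × lookup η e ≡ 𝟘 ×
                     (∀ f → ¬ Sep σ τ f →
                        (lookup η f ≡ lookup (σ ∘v τ) f) ×
                        (lookup η f ≡ lookup (τ ∘v σ) f)))

IsLoop : ∀ {n} → List (SignVec n) → Fin n → Set
IsLoop 𝓛 e = ∀ σ → σ ∈ 𝓛 → lookup σ e ≡ 𝟘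

Parallel : ∀ {n} → List (SignVec n) → Fin n → Fin n → Set
Parallel 𝓛 e f =
  ¬ IsLoop 𝓛 e × ¬ IsLoop 𝓛 f ×
  ((∀ σ → σ ∈ 𝓛 → lookup σ e ≡ lookup σ f) ⊎
   (∀ σ → σ ∈ 𝓛 → lookup σ e ≡ -negS (lookup σ f)))

IsSimple : ∀ {n} → List (SignVec n) → Set
IsSimple 𝓛 = (∀ e → ¬ IsLoop 𝓛 e) × (∀ e f → e ≢ f → ¬ Parallel 𝓛 e f)

IsTope : ∀ {n} → List (SignVec n) → SignVec n → Set
IsTope 𝓛 T = T ∈ 𝓛 × (∀ σ → σ ∈ 𝓛 → T ≤v σ → σ ≡ T)

_⊑[_]_ : ∀ {n} → SignVec n → SignVec n → SignVec n → Set
R ⊑[ B ] T = ∀ e → Sep B R e → Sep B T e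

InHull : ∀ {n} → List (SignVec n) → List (SignVec n) → SignVec n → Set
InHull 𝓛 Q T = IsTope 𝓛 T ×
  (∀ e (ε : Sign) → ε ≢ 𝟘 →
     (∀ R → R ∈ Q → lookup R e ≡ ε) → lookup T e ≡ ε)

IsConvex : ∀ {n} → List (SignVec n) → List (SignVec n) → Set
IsConvex 𝓛 Q = (∀ T → T ∈ Q → IsTope 𝓛 T) × (∀ T → InHull 𝓛 Q T → T ∈ Q)

record LinearExtension {n : ℕ} (𝓛 : List (SignVec n)) (B : SignVec n) : Set where
  field
    order    : List (SignVec n)
    unique   : Unique order
    complete : ∀ T → T ∈ order → IsTope 𝓛 T
    covers   : ∀ T → IsTope 𝓛 T → T ∈ order
    monotone : ∀ (i j : Fin (length order)) →
               L.lookup order i ⊑[ B ] L.lookup order j → toℕ i ≤ toℕ j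

QFirst : ∀ {n} {𝓛 : List (SignVec n)} {B} → LinearExtension 𝓛 B → List (SignVec n) → Set
QFirst ext Q = ∀ (i j : Fin (length order)) →
  L.lookup order i ∈ Q → L.lookup order j ∉ Q → toℕ i < toℕ j
  where open LinearExtension ext

-- Convexity makes Q closed downwards in the tope poset based at B ∈ Q: a halfspace
-- containing Q contains B and T, and R ⊑ T agrees with B wherever T does. Hence
-- sorting the topes by the key "T ∉ Q, then |S(B,T)|" gives a linear extension
-- putting Q first, because the rank |S(B,T)| strictly increases along ⊑ between
-- topes, which have full support once the matroid has no loops.
module Submission where

open import Defs
open import Data.Nat using (ℕ; suc; _+_; _≤_; _<_; z≤n)
open import Data.Nat.Properties
open import Data.Fin using (toℕ) renaming (zero to fzero; suc to fsuc)
import Data.Fin.Properties as Fin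
open import Data.Vec using ([]; _∷_; lookup)
import Data.Vec.Properties as Vec
open import Data.List using (List; _∷_; filter; deduplicate)
import Data.List as List
open import Data.List.Membership.Propositional using (_∈_; _∉_)
open import Data.List.Membership.Propositional.Properties
  using (∈-filter⁺; ∈-filter⁻; ∈-deduplicate⁺; ∈-deduplicate⁻; ∈-lookup)
import Data.List.Relation.Unary.All as All
open import Data.List.Relation.Unary.AllPairs using (_∷_)
open import Data.List.Relation.Unary.Unique.Propositional using (Unique)
import Data.List.Relation.Unary.Unique.Propositional.Properties as Unique
import Data.List.Relation.Unary.Unique.DecPropositional.Properties as UniqueDec
open import Data.List.Relation.Binary.Permutation.Propositional using (↭⇒↭ₛ; ↭-sym)
open import Data.List.Relation.Binary.Permutation.Propositional.Properties using (∈-resp-↭)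
open import Data.List.Relation.Binary.Permutation.Setoid.Properties using (Unique-resp-↭)
open import Data.List.Relation.Unary.Sorted.TotalOrder using (Sorted)
open import Data.List.Relation.Unary.Sorted.TotalOrder.Properties using (lookup-mono-≤)
import Data.List.Sort
open import Data.Product using (Σ; _×_; _,_; proj₁; proj₂)
open import Data.Sum using (_⊎_; inj₁; inj₂)
open import Data.Empty using (⊥-elim)
open import Function using (_∘_)
open import Relation.Binary.Bundles using (DecTotalOrder)
import Relation.Binary.Construct.On as On
open import Relation.Binary.PropositionalEquality
open import Relation.Nullary using (¬_; Dec; yes; no; ¬?)

_≟S_ : (s t : Sign) → Dec (s ≡ t)
⊕ ≟S ⊕ = yes refl
⊕ ≟S ⊖ = no λ ()
⊕ ≟S 𝟘 = no λ ()
⊖ ≟S ⊕ = no λ ()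
⊖ ≟S ⊖ = yes refl
⊖ ≟S 𝟘 = no λ ()
𝟘 ≟S ⊕ = no λ ()
𝟘 ≟S ⊖ = no λ ()
𝟘 ≟S 𝟘 = yes refl

_≟V_ : ∀ {n} (σ τ : SignVec n) → Dec (σ ≡ τ)
_≟V_ = Vec.≡-dec _≟S_

FullSign : ∀ {n} → SignVec n → Set
FullSign σ = ∀ e → lookup σ e ≢ 𝟘

FullSign? : ∀ {n} (σ : SignVec n) → Dec (FullSign σ)
FullSign? σ = Fin.all? (λ e → ¬? (lookup σ e ≟S 𝟘))

keyOrder : {A : Set} → (A → ℕ) → DecTotalOrder _ _ _
keyOrder = On.decTotalOrder ≤-decTotalOrder

Sorted-lookup-key< : {A : Set} (key : A → ℕ) {xs : List A} →
  Sorted (DecTotalOrder.totalOrder (keyOrder key)) xs →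
  ∀ {i j} → key (List.lookup xs i) < key (List.lookup xs j) → toℕ i < toℕ j
Sorted-lookup-key< key xs↗ k< =
  ≰⇒> λ j≤i → <⇒≱ k< (lookup-mono-≤ (DecTotalOrder.totalOrder (keyOrder key)) xs↗ j≤i)

Unique-lookup-injective : {A : Set} {xs : List A} → Unique xs →
  ∀ i j → List.lookup xs i ≡ List.lookup xs j → i ≡ j
Unique-lookup-injective (_ ∷ _) fzero fzero _ = refl
Unique-lookup-injective (x∉xs ∷ _) fzero (fsuc j) eq =
  ⊥-elim (All.lookup x∉xs (∈-lookup j) eq)
Unique-lookup-injective (x∉xs ∷ _) (fsuc i) fzero eq =
  ⊥-elim (All.lookup x∉xs (∈-lookup i) (sym eq))
Unique-lookup-injective (_ ∷ xs!) (fsuc i) (fsuc j) eq =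
  cong fsuc (Unique-lookup-injective xs! i j eq)

sepBit : Sign → Sign → ℕ
sepBit ⊕ ⊖ = 1
sepBit ⊖ ⊕ = 1
sepBit _ _ = 0

rank : ∀ {n} → SignVec n → SignVec n → ℕ
rank [] [] = 0
rank (b ∷ B) (t ∷ T) = sepBit b t + rank B T

sepBit≤1 : ∀ b t → sepBit b t ≤ 1
sepBit≤1 ⊕ ⊖ = ≤-refl
sepBit≤1 ⊖ ⊕ = ≤-refl
sepBit≤1 ⊕ ⊕ = z≤n
sepBit≤1 ⊕ 𝟘 = z≤n
sepBit≤1 ⊖ ⊖ = z≤n
sepBit≤1 ⊖ 𝟘 = z≤n
sepBit≤1 𝟘 t = z≤n

rank≤n : ∀ {n} (B T : SignVec n) → rank B T ≤ n
rank≤n [] [] = z≤n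
rank≤n (b ∷ B) (t ∷ T) = +-mono-≤ (sepBit≤1 b t) (rank≤n B T)

sepBit-strict : ∀ {b r t} → b ≢ 𝟘 → r ≢ 𝟘 → t ≢ 𝟘 →
  ((b ≡ -negS r) × (b ≢ 𝟘) → (b ≡ -negS t) × (b ≢ 𝟘)) →
  r ≡ t ⊎ sepBit b r < sepBit b t
sepBit-strict {⊕} {⊕} {⊕} _ _ _ _ = inj₁ refl
sepBit-strict {⊕} {⊖} {⊖} _ _ _ _ = inj₁ refl
sepBit-strict {⊕} {⊕} {⊖} _ _ _ _ = inj₂ ≤-refl
sepBit-strict {⊕} {⊖} {⊕} _ _ _ sep with () ← proj₁ (sep (refl , λ ()))
sepBit-strict {⊖} {⊖} {⊖} _ _ _ _ = inj₁ refl
sepBit-strict {⊖} {⊕} {⊕} _ _ _ _ = inj₁ refl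
sepBit-strict {⊖} {⊖} {⊕} _ _ _ _ = inj₂ ≤-refl
sepBit-strict {⊖} {⊕} {⊖} _ _ _ sep with () ← proj₁ (sep (refl , λ ()))
sepBit-strict {𝟘} b≢𝟘 _ _ _ = ⊥-elim (b≢𝟘 refl)
sepBit-strict {_} {𝟘} _ r≢𝟘 _ _ = ⊥-elim (r≢𝟘 refl)
sepBit-strict {_} {_} {𝟘} _ _ t≢𝟘 _ = ⊥-elim (t≢𝟘 refl)

⊑⇒≡⊎rank< : ∀ {n} {B R T : SignVec n} → FullSign B → FullSign R → FullSign T →
  R ⊑[ B ] T → R ≡ T ⊎ rank B R < rank B T
⊑⇒≡⊎rank< {B = []} {[]} {[]} _ _ _ _ = inj₁ refl
⊑⇒≡⊎rank< {B = b ∷ B} {r ∷ R} {t ∷ T} B± R± T± R⊑T =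
  combine (sepBit-strict (B± fzero) (R± fzero) (T± fzero) (R⊑T fzero))
          (⊑⇒≡⊎rank< {B = B} (B± ∘ fsuc) (R± ∘ fsuc) (T± ∘ fsuc) (R⊑T ∘ fsuc))
  where
  combine : r ≡ t ⊎ sepBit b r < sepBit b t → R ≡ T ⊎ rank B R < rank B T →
            r ∷ R ≡ t ∷ T ⊎ sepBit b r + rank B R < sepBit b t + rank B T
  combine (inj₁ refl) (inj₁ refl) = inj₁ refl
  combine (inj₁ refl) (inj₂ tail<) = inj₂ (+-monoʳ-< (sepBit b r) tail<)
  combine (inj₂ head<) (inj₁ refl) = inj₂ (+-monoˡ-< (rank B R) head<)
  combine (inj₂ head<) (inj₂ tail<) = inj₂ (+-mono-< head< tail<)

-s≢s : ∀ {s} → s ≢ 𝟘 → s ≢ -negS s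
-s≢s {⊕} _ ()
-s≢s {⊖} _ ()
-s≢s {𝟘} s≢𝟘 = ⊥-elim (s≢𝟘 refl)

¬opposite⇒≡ : ∀ {b r} → b ≢ 𝟘 → r ≢ 𝟘 → ¬ ((b ≡ -negS r) × (b ≢ 𝟘)) → r ≡ b
¬opposite⇒≡ {⊕} {⊕} _ _ _ = refl
¬opposite⇒≡ {⊖} {⊖} _ _ _ = refl
¬opposite⇒≡ {⊕} {⊖} _ _ ¬opp = ⊥-elim (¬opp (refl , λ ()))
¬opposite⇒≡ {⊖} {⊕} _ _ ¬opp = ⊥-elim (¬opp (refl , λ ()))
¬opposite⇒≡ {𝟘} b≢𝟘 _ _ = ⊥-elim (b≢𝟘 refl)
¬opposite⇒≡ {_} {𝟘} _ r≢𝟘 _ = ⊥-elim (r≢𝟘 refl)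

≤s-∘S : ∀ s t → s ≤s (s ∘S t)
≤s-∘S ⊕ t = inj₁ refl
≤s-∘S ⊖ t = inj₁ refl
≤s-∘S 𝟘 t = inj₂ refl

≤v-∘v : ∀ {n} (σ τ : SignVec n) → σ ≤v (σ ∘v τ)
≤v-∘v σ τ e =
  subst (lookup σ e ≤s_) (sym (Vec.lookup-zipWith _∘S_ e σ τ)) (≤s-∘S (lookup σ e) (lookup τ e))

lookup-ext : ∀ {n} {σ τ : SignVec n} → (∀ e → lookup σ e ≡ lookup τ e) → σ ≡ τ
lookup-ext {σ = σ} {τ} σ≗τ =
  trans (sym (Vec.tabulate∘lookup σ)) (trans (Vec.tabulate-cong σ≗τ) (Vec.tabulate∘lookup τ))

FullSign⇒IsTope : ∀ {n} {𝓛 : List (SignVec n)} {T} → T ∈ 𝓛 → FullSign T → IsTope 𝓛 T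
FullSign⇒IsTope {T = T} T∈𝓛 T± = T∈𝓛 , λ σ _ T≤σ → lookup-ext λ e → above (T≤σ e)
  where
  above : ∀ {e s} → lookup T e ≤s s → s ≡ lookup T e
  above (inj₁ Tₑ≡s) = sym Tₑ≡s
  above {e} (inj₂ Tₑ≡𝟘) = ⊥-elim (T± e Tₑ≡𝟘)

module Topes {n} {𝓛 : List (SignVec n)}
             (om : IsOrientedMatroid 𝓛) (loopless : ∀ e → ¬ IsLoop 𝓛 e) where
  open IsOrientedMatroid om

  -- Maximality gives T ∘ σ = T, so a zero of T would be a zero of every covector σ.
  IsTope⇒FullSign : ∀ {T} → IsTope 𝓛 T → FullSign T
  IsTope⇒FullSign {T} (T∈𝓛 , maximal) e Tₑ≡𝟘 = loopless e zeroAt-e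
    where
    zeroAt-e : IsLoop 𝓛 e
    zeroAt-e σ σ∈𝓛 = begin
        lookup σ e                ≡⟨ cong (_∘S lookup σ e) (sym Tₑ≡𝟘) ⟩
        lookup T e ∘S lookup σ e  ≡⟨ Vec.lookup-zipWith _∘S_ e T σ ⟨
        lookup (T ∘v σ) e         ≡⟨ cong (λ τ → lookup τ e) T∘σ≡T ⟩
        lookup T e                ≡⟨ Tₑ≡𝟘 ⟩
        𝟘                         ∎
      where
      open ≡-Reasoning
      T∘σ≡T = maximal (T ∘v σ) (comp∈ T σ T∈𝓛 σ∈𝓛) (≤v-∘v T σ)

  topes : List (SignVec n)
  topes = filter FullSign? (deduplicate _≟V_ 𝓛)

  topes-unique : Unique topes
  topes-unique = Unique.filter⁺ FullSign? (UniqueDec.deduplicate-! _≟V_ 𝓛)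

  ∈-topes⁺ : ∀ {T} → IsTope 𝓛 T → T ∈ topes
  ∈-topes⁺ T-tope =
    ∈-filter⁺ FullSign? (∈-deduplicate⁺ _≟V_ (proj₁ T-tope)) (IsTope⇒FullSign T-tope)

  ∈-topes⁻ : ∀ {T} → T ∈ topes → IsTope 𝓛 T
  ∈-topes⁻ T∈ with T∈dedup , T± ← ∈-filter⁻ FullSign? T∈ =
    FullSign⇒IsTope (∈-deduplicate⁻ _≟V_ 𝓛 T∈dedup) T±

  module _ (B : SignVec n) (key : SignVec n → ℕ)
           (key-strict : ∀ {R T} → IsTope 𝓛 R → IsTope 𝓛 T →
                         R ⊑[ B ] T → R ≡ T ⊎ key R < key T) where
    open Data.List.Sort (keyOrder key) using (sort; sort-↭; sort-↗)

    order : List (SignVec n)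
    order = sort topes

    order-unique : Unique order
    order-unique = Unique-resp-↭ (setoid _) (↭⇒↭ₛ (↭-sym (sort-↭ topes))) topes-unique

    ∈-order⁻ : ∀ {T} → T ∈ order → IsTope 𝓛 T
    ∈-order⁻ T∈ = ∈-topes⁻ (∈-resp-↭ (sort-↭ topes) T∈)

    order-key< : ∀ {i j} → key (List.lookup order i) < key (List.lookup order j) → toℕ i < toℕ j
    order-key< = Sorted-lookup-key< key (sort-↗ topes)

    order-monotone : ∀ i j → List.lookup order i ⊑[ B ] List.lookup order j → toℕ i ≤ toℕ j
    order-monotone i j ⊑ with key-strict (∈-order⁻ (∈-lookup i)) (∈-order⁻ (∈-lookup j)) ⊑
    ... | inj₁ eq = ≤-reflexive (cong toℕ (Unique-lookup-injective order-unique i j eq))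
    ... | inj₂ key< = <⇒≤ (order-key< key<)

    sortedExtension : LinearExtension 𝓛 B
    sortedExtension = record
      { order    = order
      ; unique   = order-unique
      ; complete = λ _ → ∈-order⁻
      ; covers   = λ _ T-tope → ∈-resp-↭ (↭-sym (sort-↭ topes)) (∈-topes⁺ T-tope)
      ; monotone = order-monotone
      }

  module Convex {Q : List (SignVec n)} {B : SignVec n} (convex : IsConvex 𝓛 Q) (B∈Q : B ∈ Q) where
    open import Data.List.Membership.DecPropositional (_≟V_ {n}) using (_∈?_)

    B-full : FullSign B
    B-full = IsTope⇒FullSign (proj₁ convex B B∈Q)

    ∈-convex-⊑ : ∀ {R T} → IsTope 𝓛 R → R ⊑[ B ] T → T ∈ Q → R ∈ Q
    ∈-convex-⊑ {R} {T} R-tope R⊑T T∈Q = proj₂ convex R (R-tope , inHalfspace)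
      where
      inHalfspace : ∀ e ε → ε ≢ 𝟘 → (∀ S → S ∈ Q → lookup S e ≡ ε) → lookup R e ≡ ε
      inHalfspace e ε ε≢𝟘 Q⊆ε = trans Rₑ≡Bₑ Bₑ≡ε
        where
        Bₑ≡ε = Q⊆ε B B∈Q
        ¬SepBR : ¬ Sep B R e
        ¬SepBR sep =
          -s≢s ε≢𝟘 (trans (sym Bₑ≡ε) (trans (proj₁ (R⊑T e sep)) (cong -negS (Q⊆ε T T∈Q))))
        Rₑ≡Bₑ = ¬opposite⇒≡ (B-full e) (IsTope⇒FullSign R-tope e) ¬SepBR

    -- Topes outside Q are shifted above every possible rank.
    penalty : SignVec n → ℕ
    penalty T with T ∈? Q
    ... | yes _ = 0
    ... | no _ = suc n

    penalty-∈ : ∀ {T} → T ∈ Q → penalty T ≡ 0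
    penalty-∈ {T} T∈Q with T ∈? Q
    ... | yes _ = refl
    ... | no T∉Q = ⊥-elim (T∉Q T∈Q)

    penalty-∉ : ∀ {T} → T ∉ Q → penalty T ≡ suc n
    penalty-∉ {T} T∉Q with T ∈? Q
    ... | yes T∈Q = ⊥-elim (T∉Q T∈Q)
    ... | no _ = refl

    penalty≤1+n : ∀ T → penalty T ≤ suc n
    penalty≤1+n T with T ∈? Q
    ... | yes _ = z≤n
    ... | no _ = ≤-refl

    penalty-mono : ∀ {R T} → IsTope 𝓛 R → R ⊑[ B ] T → penalty R ≤ penalty T
    penalty-mono {R} {T} R-tope R⊑T = byMembership (T ∈? Q)
      where
      byMembership : Dec (T ∈ Q) → penalty R ≤ penalty T
      byMembership (yes T∈Q) =
        ≤-reflexive (trans (penalty-∈ (∈-convex-⊑ R-tope R⊑T T∈Q)) (sym (penalty-∈ T∈Q)))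
      byMembership (no T∉Q) = subst (penalty R ≤_) (sym (penalty-∉ T∉Q)) (penalty≤1+n R)

    key : SignVec n → ℕ
    key T = penalty T + rank B T

    key-strict : ∀ {R T} → IsTope 𝓛 R → IsTope 𝓛 T → R ⊑[ B ] T → R ≡ T ⊎ key R < key T
    key-strict R-tope T-tope R⊑T
      with ⊑⇒≡⊎rank< {B = B} B-full (IsTope⇒FullSign R-tope) (IsTope⇒FullSign T-tope) R⊑T
    ... | inj₁ R≡T = inj₁ R≡T
    ... | inj₂ rank< = inj₂ (+-mono-≤-< (penalty-mono R-tope R⊑T) rank<)

    key<-∈∉ : ∀ {R T} → R ∈ Q → T ∉ Q → key R < key T
    key<-∈∉ {R} {T} R∈Q T∉Q = begin-strict
      penalty R + rank B R  ≡⟨ cong (_+ rank B R) (penalty-∈ R∈Q) ⟩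
      rank B R              ≤⟨ rank≤n B R ⟩
      n                     <⟨ n<1+n n ⟩
      suc n                 ≤⟨ m≤m+n (suc n) (rank B T) ⟩
      suc n + rank B T      ≡⟨ cong (_+ rank B T) (penalty-∉ T∉Q) ⟨
      penalty T + rank B T  ∎
      where open ≤-Reasoning

lemma2p18 : (n : ℕ) (𝓛 : List (SignVec n)) → IsOrientedMatroid 𝓛 → IsSimple 𝓛 →
    (Q : List (SignVec n)) → IsConvex 𝓛 Q →
    (B : SignVec n) → B ∈ Q →
    Σ (LinearExtension 𝓛 B) (λ ext → QFirst ext Q)
lemma2p18 n 𝓛 om (loopless , _) Q convex B B∈Q =
  sortedExtension B key key-strict ,
  λ i j i∈Q j∉Q → order-key< B key key-strict (key<-∈∉ i∈Q j∉Q)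
  where
  open Topes om loopless
  open Convex convex B∈Q
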